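{- Let $\ell$ be an odd prime. A decorated graph $(\Omega, f, g, \lambda)$ is Rado up to scaling if and only if it is weakly Rado.
   Context: Fix an odd prime $\ell$ and an isomorphism of free rank-one $\mathbb{Z}_\ell$-modules $\log_\ell: 1 + \ell\mathbb{Z}_\ell \to \mathbb{Z}_\ell$; it maps $1 + \ell^{n+1}\mathbb{Z}_\ell$ onto $\ell^n\mathbb{Z}_\ell$, so $\log_\ell(1 + \ell\alpha) \bmod \ell^n$ depends only on $\alpha \bmod \ell^n$. Write $\mathbb{Z}/\ell^\infty\mathbb{Z} := \mathbb{Z}_\ell$. A decorated graph is a tuple $(\Omega, f, g, \lambda)$ where: $\Omega$ is a countably infinite set; $f: \Omega \to \mathbb{Z}_{\geq 1} \cup \{\infty\}$ has $f^{ -1}(\infty)$ of size exactly $2$, its elements denoted $v_\ell(1), v_\ell(2)$, and $\Omega_{\mathrm{fin}} := f^{ -1}(\mathbb{Z}_{\geq 1})$; $g$ assigns to each $v \in \Omega_{\mathrm{fin}}$ an element $g(v) \in (\mathbb{Z}/\ell^{f(v)}\mathbb{Z})^\ast$; $\lambda$ assigns to each ordered pair $(v,w)$ of distinct elements not both in $\{v_\ell(1), v_\ell(2)\}$ an element $\lambda(v,w) \in \mathbb{Z}/\ell^{f(v,w)}\mathbb{Z}$, where $f(v,w) := \min(f(v), f(w))$, such that $\lambda(v_\ell(1), w) \equiv \log_\ell(1 + g(w)\ell^{f(w)}) \bmod \ell^{f(w)}$ and $\lambda(w, v_\ell(i)) = 0$ for all $w \in \Omega_{\mathrm{fin}}$,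 $i \in \{1,2\}$. Admissible data for a finite $S \subseteq \Omega$ containing $\{v_\ell(1), v_\ell(2)\}$: an integer $n \geq 1$, an $\alpha \in (\mathbb{Z}/\ell^n\mathbb{Z})^\ast$, and elements $\lambda_s(1), \lambda_s(2) \in \mathbb{Z}/\ell^{\min(n, f(s))}\mathbb{Z}$ for $s \in S$ with $\lambda_{v_\ell(1)}(2) \equiv \log_\ell(1 + \alpha\ell^n) \bmod \ell^n$ and $\lambda_{v_\ell(i)}(1) = 0$ for $i \in \{1,2\}$. The graph is Rado if for every such $S$ and every admissible data there is $v \in \Omega \setminus S$ with $f(v) = n$, $g(v) = \alpha$, and $\lambda(v,s) = \lambda_s(1)$, $\lambda(s,v) = \lambda_s(2)$ for all $s \in S$. It is weakly Rado if for every such $S$ and admissible data there exist $v \in \Omega \setminus S$ and $\gamma \in (\mathbb{Z}/\ell^n\mathbb{Z})^\ast$ with $f(v) = n$, $g(v) = \alpha$, $\lambda(v,s) = \gamma\lambda_s(1)$ and $\lambda(s,v) = \lambda_s(2)$ for all $s \in S$. For $\gamma_\bullet = (\gamma_v) \in \prod_{v \in \Omega_{\mathrm{fin}}} (\mathbb{Z}/\ell^{f(v)}\mathbb{Z})^\ast$, the scaled labeling is $(\gamma_\bullet\cdot\lambda)(v,w) := \gamma_v\lambda(v,w)$ if $v \in \Omega_{\mathrm{fin}}$ and $\lambda(v,w)$ otherwise. The graph is Rado up to scaling if some $(\Omega, f, g, \gamma_\bullet\cdot\lambda)$ is Rado. -}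

module Defs where

open import Data.Nat using (ℕ; zero; suc; _+_; _*_; _∸_; _^_; _≤_; _⊓_)
open import Data.Nat.Divisibility using (_∣_)
open import Data.Integer using (+_; _-_; ∣_∣)
open import Data.Product using (Σ; ∃; _×_)
open import Data.Sum using (_⊎_)
open import Data.List using (List)
open import Data.List.Membership.Propositional using (_∈_)
open import Relation.Nullary using (¬_)
open import Relation.Binary.PropositionalEquality using (_≡_; _≢_)
open import Function.Bundles using (_↔_)

infix 4 _≋_[mod_]
_≋_[mod_] : ℕ → ℕ → ℕ → Set
a ≋ b [mod m ] = m ∣ ∣ (+ a) - (+ b) ∣

-- Elements of ℤ/ℓ^k are represented by natural numbers; every equation
-- between such elements is read modulo ℓ^k.  An element x of ℤ/ℓ^k with
-- k ≥ 1 is a unit iff ¬ (ℓ ∣ x).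

data Lev : Set where
  fin : ℕ → Lev
  inf : Lev

fmin : ℕ → Lev → ℕ
fmin n (fin m) = n ⊓ m
fmin n inf     = n

-- The fixed isomorphism log_ℓ : 1 + ℓℤ_ℓ → ℤ_ℓ (of ℤ_ℓ-modules, mapping
-- 1 + ℓ^{n+1}ℤ_ℓ onto ℓ^nℤ_ℓ) is recorded through its finite levels:
-- L n α represents log_ℓ(1 + ℓα) mod ℓ^n.  Such a compatible system of
-- group isomorphisms (1+ℓℤ)/(1+ℓ^{n+1}ℤ) ≅ ℤ/ℓ^n is the same thing as
-- such an isomorphism log_ℓ.
record LogSystem (ℓ : ℕ) : Set where
  field
    L      : ℕ → ℕ → ℕ
    wd     : ∀ n α β → α ≋ β [mod ℓ ^ n ] → L n α ≋ L n β [mod ℓ ^ n ]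
    hom    : ∀ n α β → L n (α + β + ℓ * α * β) ≋ L n α + L n β [mod ℓ ^ n ]
    compat : ∀ n α → L (suc n) α ≋ L n α [mod ℓ ^ n ]
    inj    : ∀ n α β → L n α ≋ L n β [mod ℓ ^ n ] → α ≋ β [mod ℓ ^ n ]
    surj   : ∀ n y → ∃ λ α → L n α ≋ y [mod ℓ ^ n ]

-- log_ℓ(1 + u ℓ^k) mod ℓ^k, for k ≥ 1 (note 1 + uℓ^k = 1 + ℓ(uℓ^{k-1})).
logAt : {ℓ : ℕ} → LogSystem ℓ → ℕ → ℕ → ℕ
logAt {ℓ} Lg k u = LogSystem.L Lg k (u * ℓ ^ (k ∸ 1))

-- A decorated graph (Ω, f, g, λ).  λ and g are total functions on Ω,
-- but only their values on the pairs / vertices named in the paper are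
-- constrained (and only those are ever used).
record DecGraph (ℓ : ℕ) (Lg : LogSystem ℓ) : Set₁ where
  field
    Ω        : Set
    countable : Ω ↔ ℕ
    f        : Ω → Lev
    v∞₁ v∞₂  : Ω
    v∞-distinct : v∞₁ ≢ v∞₂
    f-v∞₁    : f v∞₁ ≡ inf
    f-v∞₂    : f v∞₂ ≡ inf
    f-inf    : ∀ v → f v ≡ inf → v ≡ v∞₁ ⊎ v ≡ v∞₂
    f-pos    : ∀ v n → f v ≡ fin n → 1 ≤ n
    g        : Ω → ℕ
    g-unit   : ∀ v n → f v ≡ fin n → ¬ (ℓ ∣ g v)
    lab      : Ω → Ω → ℕ
    lab-v∞₁  : ∀ w n → f w ≡ fin n →
               lab v∞₁ w ≋ logAt Lg n (g w) [mod ℓ ^ n ]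
    lab-to-v∞₁ : ∀ w n → f w ≡ fin n → lab w v∞₁ ≋ 0 [mod ℓ ^ n ]
    lab-to-v∞₂ : ∀ w n → f w ≡ fin n → lab w v∞₂ ≋ 0 [mod ℓ ^ n ]

module _ {ℓ : ℕ} {Lg : LogSystem ℓ} (G : DecGraph ℓ Lg) where
  open DecGraph G

  record Admissible (S : List Ω) : Set where
    field
      n     : ℕ
      n≥1   : 1 ≤ n
      α     : ℕ
      α-unit : ¬ (ℓ ∣ α)
      λs₁ λs₂ : Ω → ℕ
      λ-v∞₁-2 : λs₂ v∞₁ ≋ logAt Lg n α [mod ℓ ^ n ]
      λ-v∞₁-1 : λs₁ v∞₁ ≋ 0 [mod ℓ ^ n ]
      λ-v∞₂-1 : λs₁ v∞₂ ≋ 0 [mod ℓ ^ n ]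

  IsRado : (Ω → Ω → ℕ) → Set
  IsRado μ = (S : List Ω) → v∞₁ ∈ S → v∞₂ ∈ S → (D : Admissible S) →
    let open Admissible D in
    Σ Ω λ v → ¬ (v ∈ S) × f v ≡ fin n × g v ≋ α [mod ℓ ^ n ] ×
      (∀ s → s ∈ S → μ v s ≋ λs₁ s [mod ℓ ^ fmin n (f s) ]
                   × μ s v ≋ λs₂ s [mod ℓ ^ fmin n (f s) ])

  Rado : Set
  Rado = IsRado lab

  WeaklyRado : Set
  WeaklyRado = (S : List Ω) → v∞₁ ∈ S → v∞₂ ∈ S → (D : Admissible S) →
    let open Admissible D in
    Σ Ω λ v → Σ ℕ λ γ → ¬ (ℓ ∣ γ) × ¬ (v ∈ S) × f v ≡ fin n × g v ≋ α [mod ℓ ^ n ] ×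
      (∀ s → s ∈ S → lab v s ≋ γ * λs₁ s [mod ℓ ^ fmin n (f s) ]
                   × lab s v ≋ λs₂ s [mod ℓ ^ fmin n (f s) ])

  scaleAt : Lev → ℕ → ℕ → ℕ
  scaleAt (fin _) c x = c * x
  scaleAt inf     c x = x

  scale : (Ω → ℕ) → Ω → Ω → ℕ
  scale γ v w = scaleAt (f v) (γ v) (lab v w)

  RadoUpToScaling : Set
  RadoUpToScaling = Σ (Ω → ℕ) λ γ →
    (∀ v n → f v ≡ fin n → ¬ (ℓ ∣ γ v)) × IsRado (scale γ)

module Submission where

-- Rescaling the outgoing labels of a vertex v by a unit γ_v turns a witness for the rescaled graph
-- into a weak witness with factor γ_v⁻¹; incoming labels only change by units γ_s, which cancel.
-- Conversely, code every finite S with admissible data by a natural number and answer the requests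
-- in turn with the weak Rado property, asking for incoming labels already divided by the scalings
-- fixed so far and fixing γ_v as the inverse of the returned factor at the fresh vertex v.  Fresh
-- vertices avoid everything fixed before, so the scalings stabilise, and the limit makes the graph
-- Rado.

open import Defs
open import Data.Nat using (ℕ)
open import Data.Nat.Divisibility using (_∣_)
open import Data.Nat.Primality using (Prime)
open import Relation.Nullary using (¬_)
open import Function.Bundles using (_⇔_)

open import Data.Nat using (zero; suc; _+_; _*_; _∸_; _^_; _≤_; _<_; z≤n; s≤s; nonTrivial⇒≢1)
import Data.Nat.Properties as ℕ
open import Data.Nat.Divisibility using (_∣?_; ∣-trans; m∣m*n; ∣m⇒∣m*n; ∣1⇒≡1)
open import Data.Nat.Coprimality using (Coprime; coprime-Bézout; coprime-divisor; 1-coprimeTo)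
import Data.Nat.Coprimality as Coprime
open import Data.Nat.GCD using (module Bézout)
open import Data.Nat.Primality using (prime⇒nonTrivial; prime⇒irreducible)
open import Data.Integer as ℤ using (ℤ; +_)
import Data.Integer.Properties as ℤ
import Data.Integer.Divisibility.Signed as ℤ∣
open import Data.Integer.Tactic.RingSolver using (solve-∀)
open import Data.Empty using (⊥-elim)
open import Data.Sum using (inj₁; inj₂)
open import Data.Product using (Σ; _×_; ∃-syntax; _,_; proj₁; proj₂)
open import Data.List using (List; []; _∷_; _++_; map; applyUpTo)
open import Data.List.Membership.Propositional using (_∈_)
open import Data.List.Membership.Propositional.Properties using (∈-applyUpTo⁺; ∈-++⁺ˡ; ∈-++⁺ʳ)
open import Data.List.Relation.Unary.Any using (here; there)
import Data.List.Relation.Unary.Any as Any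
import Data.List.Relation.Unary.Any.Properties as Anyₚ
open import Data.List.Extrema.Nat using (max; v<max⁺)
open import Function using (_∘_)
open import Function.Bundles using (Inverse; mk⇔)
open import Function.Properties.Inverse using (↔⇒↣)
open import Level using (0ℓ)
open import Relation.Nullary using (yes; no)
open import Relation.Nullary.Decidable using (via-injection)
open import Relation.Binary.Bundles using (Setoid)
open import Relation.Binary.Definitions using (DecidableEquality)
import Relation.Binary.Reasoning.Setoid
open import Relation.Binary.PropositionalEquality
  using (_≡_; _≢_; refl; sym; trans; cong; cong₂; subst; subst₂; module ≡-Reasoning)

-- An opaque copy of _≋_[mod_], so that Agda can infer a and b from a ≈ b [mod m ].
opaque
  infix 4 _≈_[mod_]
  _≈_[mod_] : ℕ → ℕ → ℕ → Set
  a ≈ b [mod m ] = a ≋ b [mod m ]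

  ≋⇒≈ : ∀ {a b m} → a ≋ b [mod m ] → a ≈ b [mod m ]
  ≋⇒≈ p = p

  ≈⇒≋ : ∀ {a b m} → a ≈ b [mod m ] → a ≋ b [mod m ]
  ≈⇒≋ p = p

  private
    ≈⇒∣ : ∀ {a b m} → a ≈ b [mod m ] → + m ℤ∣.∣ (+ a ℤ.- + b)
    ≈⇒∣ {a} {b} {m} = ℤ∣.∣ᵤ⇒∣ {+ m} {+ a ℤ.- + b}

    ∣⇒≈ : ∀ {a b m} → + m ℤ∣.∣ (+ a ℤ.- + b) → a ≈ b [mod m ]
    ∣⇒≈ = ℤ∣.∣⇒∣ᵤ

  ≈-refl : ∀ {a m} → a ≈ a [mod m ]
  ≈-refl {a} = ∣⇒≈ {a} {a} (ℤ∣.divides (+ 0) (ℤ.+-inverseʳ (+ a)))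

  ≈-sym : ∀ {a b m} → a ≈ b [mod m ] → b ≈ a [mod m ]
  ≈-sym {a} {b} {m} p =
    ∣⇒≈ {b} {a} (subst (+ m ℤ∣.∣_) (negate-diff (+ a) (+ b)) (ℤ∣.∣m⇒∣-m (≈⇒∣ {a} {b} p)))
    where
    negate-diff : ∀ x y → ℤ.- (x ℤ.- y) ≡ y ℤ.- x
    negate-diff = solve-∀

  ≈-trans : ∀ {a b c m} → a ≈ b [mod m ] → b ≈ c [mod m ] → a ≈ c [mod m ]
  ≈-trans {a} {b} {c} {m} p q =
    ∣⇒≈ {a} {c} (subst (+ m ℤ∣.∣_) (telescope (+ a) (+ b) (+ c))
      (ℤ∣.∣m∣n⇒∣m+n (≈⇒∣ {a} {b} p) (≈⇒∣ {b} {c} q)))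
    where
    telescope : ∀ x y z → (x ℤ.- y) ℤ.+ (y ℤ.- z) ≡ x ℤ.- z
    telescope = solve-∀

  *-congˡ-≈ : ∀ c {a b m} → a ≈ b [mod m ] → c * a ≈ c * b [mod m ]
  *-congˡ-≈ c {a} {b} {m} p =
    ∣⇒≈ {c * a} {c * b} (subst (+ m ℤ∣.∣_) distrib (ℤ∣.∣n⇒∣m*n (+ c) (≈⇒∣ {a} {b} p)))
    where
    distrib : + c ℤ.* (+ a ℤ.- + b) ≡ + (c * a) ℤ.- + (c * b)
    distrib = trans (distribˡ (+ c) (+ a) (+ b))
      (sym (cong₂ ℤ._-_ (ℤ.pos-* c a) (ℤ.pos-* c b)))
      where
      distribˡ : ∀ z x y → z ℤ.* (x ℤ.- y) ≡ z ℤ.* x ℤ.- z ℤ.* y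
      distribˡ = solve-∀

  ≈-∣ : ∀ {a b d m} → d ∣ m → a ≈ b [mod m ] → a ≈ b [mod d ]
  ≈-∣ = ∣-trans

  ∣-resp-≈ : ∀ {a b m} → a ≈ b [mod m ] → m ∣ a → m ∣ b
  ∣-resp-≈ {a} {b} {m} p m∣a = ℤ∣.∣⇒∣ᵤ {+ m} {+ b}
    (subst (+ m ℤ∣.∣_) (cancel (+ a) (+ b))
      (ℤ∣.∣m∣n⇒∣m-n (ℤ∣.∣ᵤ⇒∣ {+ m} {+ a} m∣a) (≈⇒∣ {a} {b} p)))
    where
    cancel : ∀ x y → x ℤ.- (x ℤ.- y) ≡ y
    cancel = solve-∀

  -- Bézout gives a x ≡ ± 1 modulo m; in the − case the inverse is a (a x).
  coprime⇒invertible : ∀ {m x} → Coprime m x → ∃[ y ] y * x ≈ 1 [mod m ]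
  coprime⇒invertible {m} {x} m⊥x with coprime-Bézout (Coprime.sym m⊥x)
  ... | Bézout.+- a b eq = a , ∣⇒≈ {a * x} {1} (ℤ∣.divides (+ b) (begin
    + (a * x) ℤ.- + 1             ≡⟨ cong (λ z → + z ℤ.- + 1) eq ⟨
    + (1 + b * m) ℤ.- + 1         ≡⟨ cong (ℤ._- + 1) (ℤ.pos-+ 1 (b * m)) ⟩
    + 1 ℤ.+ + (b * m) ℤ.- + 1     ≡⟨ cong (λ z → + 1 ℤ.+ z ℤ.- + 1) (ℤ.pos-* b m) ⟩
    + 1 ℤ.+ + b ℤ.* + m ℤ.- + 1   ≡⟨ cancel (+ b ℤ.* + m) ⟩
    + b ℤ.* + m                   ∎))
    where
    open ≡-Reasoning
    cancel : ∀ z → + 1 ℤ.+ z ℤ.- + 1 ≡ z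
    cancel = solve-∀
  ... | Bézout.-+ a b eq = a * (a * x) , ∣⇒≈ {a * (a * x) * x} {1}
    (ℤ∣.divides ((U ℤ.- + 1) ℤ.* + b) (begin
    + (a * (a * x) * x) ℤ.- + 1        ≡⟨ cong (λ z → + z ℤ.- + 1) (square a x) ⟩
    + (a * x * (a * x)) ℤ.- + 1        ≡⟨ cong (ℤ._- + 1) (ℤ.pos-* (a * x) (a * x)) ⟩
    U ℤ.* U ℤ.- + 1                    ≡⟨ difference-of-squares U ⟩
    (U ℤ.- + 1) ℤ.* (+ 1 ℤ.+ U)        ≡⟨ cong ((U ℤ.- + 1) ℤ.*_) U+1≡bm ⟩
    (U ℤ.- + 1) ℤ.* (+ b ℤ.* + m)      ≡⟨ ℤ.*-assoc (U ℤ.- + 1) (+ b) (+ m) ⟨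
    (U ℤ.- + 1) ℤ.* + b ℤ.* + m        ∎))
    where
    open ≡-Reasoning
    U : ℤ
    U = + (a * x)
    difference-of-squares : ∀ z → z ℤ.* z ℤ.- + 1 ≡ (z ℤ.- + 1) ℤ.* (+ 1 ℤ.+ z)
    difference-of-squares = solve-∀
    U+1≡bm : + 1 ℤ.+ U ≡ + b ℤ.* + m
    U+1≡bm = trans (sym (ℤ.pos-+ 1 (a * x))) (trans (cong +_ eq) (ℤ.pos-* b m))
    square : ∀ a x → a * (a * x) * x ≡ a * x * (a * x)
    square a x = trans (ℕ.*-assoc a (a * x) x)
      (trans (cong (a *_) (ℕ.*-comm (a * x) x)) (sym (ℕ.*-assoc a x (a * x))))

≈-setoid : ℕ → Setoid 0ℓ 0ℓ
≈-setoid m = record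
  { Carrier = ℕ
  ; _≈_ = _≈_[mod m ]
  ; isEquivalence = record { refl = ≈-refl ; sym = ≈-sym ; trans = ≈-trans }
  }

module ≈-Reasoning (m : ℕ) = Relation.Binary.Reasoning.Setoid (≈-setoid m)

≈-reflexive : ∀ {a b m} → a ≡ b → a ≈ b [mod m ]
≈-reflexive refl = ≈-refl

module _ {m : ℕ} (y c : ℕ) (y*c≈1 : y * c ≈ 1 [mod m ]) where
  open ≈-Reasoning m

  y*[c*a]≈a : ∀ a → y * (c * a) ≈ a [mod m ]
  y*[c*a]≈a a = begin
    y * (c * a)  ≡⟨ ℕ.*-assoc y c a ⟨
    y * c * a    ≡⟨ ℕ.*-comm (y * c) a ⟩
    a * (y * c)  ≈⟨ *-congˡ-≈ a y*c≈1 ⟩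
    a * 1        ≡⟨ ℕ.*-identityʳ a ⟩
    a            ∎

  c*[y*a]≈a : ∀ a → c * (y * a) ≈ a [mod m ]
  c*[y*a]≈a a = begin
    c * (y * a)  ≡⟨ ℕ.*-assoc c y a ⟨
    c * y * a    ≡⟨ cong (_* a) (ℕ.*-comm c y) ⟩
    y * c * a    ≡⟨ ℕ.*-assoc y c a ⟩
    y * (c * a)  ≈⟨ y*[c*a]≈a a ⟩
    a            ∎

  c*a≈b⇒a≈y*b : ∀ {a b} → c * a ≈ b [mod m ] → a ≈ y * b [mod m ]
  c*a≈b⇒a≈y*b {a} {b} p = begin
    a            ≈⟨ y*[c*a]≈a a ⟨
    y * (c * a)  ≈⟨ *-congˡ-≈ y p ⟩
    y * b        ∎

  a≈c*b⇒y*a≈b : ∀ {a b} → a ≈ c * b [mod m ] → y * a ≈ b [mod m ]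
  a≈c*b⇒y*a≈b {a} {b} p = begin
    y * a        ≈⟨ *-congˡ-≈ y p ⟩
    y * (c * b)  ≈⟨ y*[c*a]≈a b ⟩
    b            ∎

  a≈y*b⇒c*a≈b : ∀ {a b} → a ≈ y * b [mod m ] → c * a ≈ b [mod m ]
  a≈y*b⇒c*a≈b {a} {b} p = begin
    c * a        ≈⟨ *-congˡ-≈ c p ⟩
    c * (y * b)  ≈⟨ c*[y*a]≈a b ⟩
    b            ∎

  c*a≈c*b⇒a≈b : ∀ {a b} → c * a ≈ c * b [mod m ] → a ≈ b [mod m ]
  c*a≈c*b⇒a≈b {a} {b} p = begin
    a            ≈⟨ c*a≈b⇒a≈y*b p ⟩
    y * (c * b)  ≈⟨ y*[c*a]≈a b ⟩
    b            ∎

^-monoʳ-∣ : ∀ ℓ {a b} → a ≤ b → ℓ ^ a ∣ ℓ ^ b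
^-monoʳ-∣ ℓ {a} {b} a≤b = subst (ℓ ^ a ∣_)
  (trans (sym (ℕ.^-distribˡ-+-* ℓ a (b ∸ a))) (cong (ℓ ^_) (ℕ.m+[n∸m]≡n a≤b)))
  (m∣m*n (ℓ ^ (b ∸ a)))

fmin≤ : ∀ n L → fmin n L ≤ n
fmin≤ n (fin m) = ℕ.m⊓n≤m n m
fmin≤ n inf     = ℕ.≤-refl

next : ℕ × ℕ → ℕ × ℕ
next (a , zero)  = 0 , suc a
next (a , suc b) = suc a , b

unpair : ℕ → ℕ × ℕ
unpair zero    = 0 , 0
unpair (suc k) = next (unpair k)

unpair-surjective : ∀ a b → ∃[ k ] unpair k ≡ (a , b)
unpair-surjective a b = onDiagonal (a + b) a b refl
  where
  onDiagonal : ∀ d a b → a + b ≡ d → ∃[ k ] unpair k ≡ (a , b)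
  onDiagonal d (suc a) b a+b≡d
    with k , eq ← onDiagonal d a (suc b) (trans (ℕ.+-suc a b) a+b≡d)
    = suc k , cong next eq
  onDiagonal (suc d) zero (suc b) b+1≡d+1
    with k , eq ← onDiagonal d b 0 (trans (ℕ.+-identityʳ b) (ℕ.suc-injective b+1≡d+1))
    = suc k , cong next eq
  onDiagonal _ zero zero _ = 0 , refl

pair : ℕ → ℕ → ℕ
pair a b = proj₁ (unpair-surjective a b)

unpair-pair : ∀ a b → unpair (pair a b) ≡ (a , b)
unpair-pair a b = proj₂ (unpair-surjective a b)

stream : ℕ → ℕ → ℕ
stream c zero    = proj₁ (unpair c)
stream c (suc i) = stream (proj₂ (unpair c)) i

stream-prefix : ∀ (h : ℕ → ℕ) M → ∃[ c ] (∀ i → i < M → stream c i ≡ h i)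
stream-prefix h zero = 0 , λ _ ()
stream-prefix h (suc M) with c , agrees ← stream-prefix (h ∘ suc) M =
  pair (h 0) c , agrees′
  where
  agrees′ : ∀ i → i < suc M → stream (pair (h 0) c) i ≡ h i
  agrees′ zero    _         = cong proj₁ (unpair-pair (h 0) c)
  agrees′ (suc i) (s≤s i<M) =
    trans (cong (λ c′ → stream c′ i) (cong proj₂ (unpair-pair (h 0) c))) (agrees i i<M)

module _ {ℓ : ℕ} (ℓ-prime : Prime ℓ) where

  ℓ∤1 : ¬ ℓ ∣ 1
  ℓ∤1 ℓ∣1 = nonTrivial⇒≢1 {{prime⇒nonTrivial ℓ-prime}} (∣1⇒≡1 ℓ∣1)

  ∤⇒coprime : ∀ {x} → ¬ ℓ ∣ x → Coprime ℓ x
  ∤⇒coprime ℓ∤x (d∣ℓ , d∣x) with prime⇒irreducible ℓ-prime d∣ℓ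
  ... | inj₁ d≡1 = d≡1
  ... | inj₂ refl = ⊥-elim (ℓ∤x d∣x)

  ∤⇒coprime-^ : ∀ {x} → ¬ ℓ ∣ x → ∀ m → Coprime (ℓ ^ m) x
  ∤⇒coprime-^ {x} ℓ∤x zero    = 1-coprimeTo x
  ∤⇒coprime-^ {x} ℓ∤x (suc m) {d} (d∣ℓ*ℓ^m , d∣x) = ∤⇒coprime ℓ∤x (d∣ℓ , d∣x)
    where
    d⊥ℓ^m : Coprime d (ℓ ^ m)
    d⊥ℓ^m (e∣d , e∣ℓ^m) = ∤⇒coprime-^ ℓ∤x m (e∣ℓ^m , ∣-trans e∣d d∣x)
    d∣ℓ : d ∣ ℓ
    d∣ℓ = coprime-divisor d⊥ℓ^m (subst (d ∣_) (ℕ.*-comm ℓ (ℓ ^ m)) d∣ℓ*ℓ^m)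

  ≈1⇒∤ : ∀ {m y x} → 1 ≤ m → y * x ≈ 1 [mod ℓ ^ m ] → ¬ ℓ ∣ y
  ≈1⇒∤ {suc m} {y} {x} _ y*x≈1 ℓ∣y =
    ℓ∤1 (∣-resp-≈ (≈-∣ (m∣m*n (ℓ ^ m)) y*x≈1) (∣m⇒∣m*n x ℓ∣y))

  inv : ℕ → ℕ → ℕ
  inv m x with ℓ ∣? x
  ... | yes _   = 1
  ... | no ℓ∤x  = proj₁ (coprime⇒invertible (∤⇒coprime-^ ℓ∤x m))

  inv-inverse : ∀ m {x} → ¬ ℓ ∣ x → inv m x * x ≈ 1 [mod ℓ ^ m ]
  inv-inverse m {x} ℓ∤x with ℓ ∣? x
  ... | yes ℓ∣x  = ⊥-elim (ℓ∤x ℓ∣x)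
  ... | no ℓ∤x′  = proj₂ (coprime⇒invertible (∤⇒coprime-^ ℓ∤x′ m))

  inv-inverse-≤ : ∀ {k} m {x} → k ≤ m → ¬ ℓ ∣ x → inv m x * x ≈ 1 [mod ℓ ^ k ]
  inv-inverse-≤ m k≤m ℓ∤x = ≈-∣ (^-monoʳ-∣ ℓ k≤m) (inv-inverse m ℓ∤x)

  inv-∤ : ∀ {m} x → 1 ≤ m → ¬ ℓ ∣ inv m x
  inv-∤ {m} x 1≤m with ℓ ∣? x
  ... | yes _   = ℓ∤1
  ... | no ℓ∤x  = ≈1⇒∤ 1≤m (proj₂ (coprime⇒invertible (∤⇒coprime-^ ℓ∤x m)))

  unitOrOne : ℕ → ℕ
  unitOrOne a with ℓ ∣? a
  ... | yes _ = 1
  ... | no _  = a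

  unitOrOne-∤ : ∀ a → ¬ ℓ ∣ unitOrOne a
  unitOrOne-∤ a with ℓ ∣? a
  ... | yes _   = ℓ∤1
  ... | no ℓ∤a  = ℓ∤a

  ∤⇒unitOrOne≡id : ∀ {a} → ¬ ℓ ∣ a → unitOrOne a ≡ a
  ∤⇒unitOrOne≡id {a} ℓ∤a with ℓ ∣? a
  ... | yes ℓ∣a = ⊥-elim (ℓ∤a ℓ∣a)
  ... | no _    = refl

  unscaleAt : Lev → ℕ → ℕ → ℕ
  unscaleAt (fin m) c x = inv m c * x
  unscaleAt inf     _ x = x

  module _ {Lg : LogSystem ℓ} (G : DecGraph ℓ Lg) where
    open DecGraph G

    -- IsRado μ unfolds to ∀ S _ _ D → Σ Ω (Realises μ S n α λs₁ λs₂) for the fields of D,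
    -- and WeaklyRado to ∀ S _ _ D → WeakReply S n α λs₁ λs₂.
    Realises : (Ω → Ω → ℕ) → List Ω → ℕ → ℕ → (Ω → ℕ) → (Ω → ℕ) → Ω → Set
    Realises μ S n α λ₁ λ₂ v = ¬ (v ∈ S) × f v ≡ fin n × g v ≋ α [mod ℓ ^ n ] ×
      (∀ s → s ∈ S → μ v s ≋ λ₁ s [mod ℓ ^ fmin n (f s) ]
                   × μ s v ≋ λ₂ s [mod ℓ ^ fmin n (f s) ])

    WeakReply : List Ω → ℕ → ℕ → (Ω → ℕ) → (Ω → ℕ) → Set
    WeakReply S n α λ₁ λ₂ =
      Σ Ω λ v → Σ ℕ λ c → ¬ ℓ ∣ c × Realises lab S n α (λ s → c * λ₁ s) λ₂ v

    scaleAt-fin : ∀ {L m c x} → L ≡ fin m → scaleAt G L c x ≡ c * x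
    scaleAt-fin refl = refl

    scaleAt-cancel : ∀ L n {c y z} → (∀ m → L ≡ fin m → ¬ ℓ ∣ c) →
      scaleAt G L c y ≋ scaleAt G L c z [mod ℓ ^ fmin n L ] → y ≋ z [mod ℓ ^ fmin n L ]
    scaleAt-cancel inf     _ _ p = p
    scaleAt-cancel (fin m) n {c} c-unit p = ≈⇒≋
      (c*a≈c*b⇒a≈b (inv m c) c (inv-inverse-≤ m (ℕ.m⊓n≤n n m) (c-unit m refl)) (≋⇒≈ p))

    scaleAt-unscaleAt : ∀ L n {c y z} → (∀ m → L ≡ fin m → ¬ ℓ ∣ c) →
      y ≋ unscaleAt L c z [mod ℓ ^ fmin n L ] → scaleAt G L c y ≋ z [mod ℓ ^ fmin n L ]
    scaleAt-unscaleAt inf     _ _ p = p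
    scaleAt-unscaleAt (fin m) n {c} c-unit p = ≈⇒≋
      (a≈y*b⇒c*a≈b (inv m c) c (inv-inverse-≤ m (ℕ.m⊓n≤n n m) (c-unit m refl)) (≋⇒≈ p))

    realises-unscale : ∀ {γ S n α λ₁ λ₂ v} → (∀ w m → f w ≡ fin m → ¬ ℓ ∣ γ w) →
      Realises (scale G γ) S n α λ₁ (λ s → scaleAt G (f s) (γ s) (λ₂ s)) v →
      Realises lab S n α (λ s → inv n (γ v) * λ₁ s) λ₂ v
    realises-unscale {γ} {S} {n} {λ₁ = λ₁} {λ₂} {v} γ-unit (v∉S , fv , gv , edges) =
      v∉S , fv , gv , edges′
      where
      edges′ : ∀ s → s ∈ S → lab v s ≋ inv n (γ v) * λ₁ s [mod ℓ ^ fmin n (f s) ]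
                           × lab s v ≋ λ₂ s [mod ℓ ^ fmin n (f s) ]
      edges′ s s∈S = ≈⇒≋ (c*a≈b⇒a≈y*b (inv n (γ v)) (γ v)
                       (inv-inverse-≤ n (fmin≤ n (f s)) (γ-unit v n fv))
                       (≈-trans (≈-reflexive (sym (scaleAt-fin fv))) (≋⇒≈ (proj₁ (edges s s∈S)))))
                   , scaleAt-cancel (f s) n (γ-unit s) (proj₂ (edges s s∈S))

    realises-scale : ∀ {γ γ′ λ₁ λ₂ : Ω → ℕ} {S n α v c} → ¬ ℓ ∣ c → γ v ≡ inv n c →
      (∀ {s} → s ∈ S → γ s ≡ γ′ s) → (∀ s m → f s ≡ fin m → ¬ ℓ ∣ γ′ s) →
      Realises lab S n α (λ s → c * λ₁ s) (λ s → unscaleAt (f s) (γ′ s) (λ₂ s)) v →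
      Realises (scale G γ) S n α λ₁ λ₂ v
    realises-scale {γ} {γ′} {λ₁} {λ₂} {S} {n} {v = v} {c} c-unit γv≡c⁻¹ γ≡γ′ γ′-unit
      (v∉S , fv , gv , edges) = v∉S , fv , gv , edges′
      where
      edges′ : ∀ s → s ∈ S → scale G γ v s ≋ λ₁ s [mod ℓ ^ fmin n (f s) ]
                           × scale G γ s v ≋ λ₂ s [mod ℓ ^ fmin n (f s) ]
      edges′ s s∈S = ≈⇒≋ out , into
        where
        open ≈-Reasoning (ℓ ^ fmin n (f s))
        out : scale G γ v s ≈ λ₁ s [mod ℓ ^ fmin n (f s) ]
        out = begin
          scale G γ v s      ≡⟨ scaleAt-fin fv ⟩
          γ v * lab v s      ≡⟨ cong (_* lab v s) γv≡c⁻¹ ⟩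
          inv n c * lab v s  ≈⟨ a≈c*b⇒y*a≈b (inv n c) c (inv-inverse-≤ n (fmin≤ n (f s)) c-unit)
                                  (≋⇒≈ (proj₁ (edges s s∈S))) ⟩
          λ₁ s               ∎
        into : scale G γ s v ≋ λ₂ s [mod ℓ ^ fmin n (f s) ]
        into = subst (λ x → scaleAt G (f s) x (lab s v) ≋ λ₂ s [mod ℓ ^ fmin n (f s) ])
          (sym (γ≡γ′ s∈S)) (scaleAt-unscaleAt (f s) n (γ′-unit s) (proj₂ (edges s s∈S)))

    realises-restrict : ∀ {μ S S′ n α λ₁ λ₁′ λ₂ λ₂′ v} → (∀ {s} → s ∈ S → s ∈ S′) →
      (∀ {s} → s ∈ S → λ₁′ s ≋ λ₁ s [mod ℓ ^ fmin n (f s) ]) →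
      (∀ {s} → s ∈ S → λ₂′ s ≋ λ₂ s [mod ℓ ^ fmin n (f s) ]) →
      Realises μ S′ n α λ₁′ λ₂′ v → Realises μ S n α λ₁ λ₂ v
    realises-restrict {μ} {S} {n = n} {λ₁ = λ₁} {λ₁′} {λ₂} {λ₂′} {v} S⊆S′ agree₁ agree₂
      (v∉S′ , fv , gv , edges) = v∉S′ ∘ S⊆S′ , fv , gv , edges′
      where
      edges′ : ∀ s → s ∈ S → μ v s ≋ λ₁ s [mod ℓ ^ fmin n (f s) ]
                           × μ s v ≋ λ₂ s [mod ℓ ^ fmin n (f s) ]
      edges′ s s∈S = ≈⇒≋ (begin
          μ v s   ≈⟨ ≋⇒≈ (proj₁ (edges s (S⊆S′ s∈S))) ⟩
          λ₁′ s   ≈⟨ ≋⇒≈ (agree₁ s∈S) ⟩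
          λ₁ s    ∎)
        , ≈⇒≋ (begin
          μ s v   ≈⟨ ≋⇒≈ (proj₂ (edges s (S⊆S′ s∈S))) ⟩
          λ₂′ s   ≈⟨ ≋⇒≈ (agree₂ s∈S) ⟩
          λ₂ s    ∎)
        where open ≈-Reasoning (ℓ ^ fmin n (f s))

    scaleIncoming : ∀ {S} → (Ω → ℕ) → Admissible G S → Admissible G S
    scaleIncoming γ D = record D
      { λs₂ = λ s → scaleAt G (f s) (γ s) (λs₂ s)
      ; λ-v∞₁-2 = subst (λ L → scaleAt G L (γ v∞₁) (λs₂ v∞₁) ≋ logAt Lg n α [mod ℓ ^ n ])
                    (sym f-v∞₁) λ-v∞₁-2
      }
      where open Admissible D

    radoUpToScaling⇒weaklyRado : RadoUpToScaling G → WeaklyRado G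
    radoUpToScaling⇒weaklyRado (γ , γ-unit , rado) S v∞₁∈S v∞₂∈S D
      with v , realised ← rado S v∞₁∈S v∞₂∈S (scaleIncoming γ D) =
      v , inv n (γ v) , inv-∤ (γ v) n≥1 , realises-unscale {α = α} γ-unit realised
      where open Admissible D

    idx : Ω → ℕ
    idx = Inverse.to countable

    vtx : ℕ → Ω
    vtx = Inverse.from countable

    vtx-idx : ∀ w → vtx (idx w) ≡ w
    vtx-idx = Inverse.strictlyInverseʳ countable

    _≟Ω_ : DecidableEquality Ω
    _≟Ω_ = via-injection (↔⇒↣ countable) ℕ._≟_

    _[_≔_] : (Ω → ℕ) → Ω → ℕ → Ω → ℕ
    (γ [ v ≔ x ]) w with w ≟Ω v
    ... | yes _ = x
    ... | no _  = γ w

    [≔]-≡ : ∀ {γ v x} → (γ [ v ≔ x ]) v ≡ x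
    [≔]-≡ {v = v} with v ≟Ω v
    ... | yes _  = refl
    ... | no v≢v = ⊥-elim (v≢v refl)

    [≔]-≢ : ∀ {γ v x w} → w ≢ v → (γ [ v ≔ x ]) w ≡ γ w
    [≔]-≢ {v = v} {w = w} w≢v with w ≟Ω v
    ... | yes w≡v = ⊥-elim (w≢v w≡v)
    ... | no _    = refl

    -- Request k reads S, n, α and the labels of vtx i off the stream coded by k; the values
    -- at v∞₁, v∞₂ and α are overridden so that every request is admissible.
    reqSet : ℕ → List Ω
    reqSet k = v∞₁ ∷ v∞₂ ∷ applyUpTo vtx (stream k 0)

    reqLevel : ℕ → ℕ
    reqLevel k = suc (stream k 1)

    reqUnit : ℕ → ℕ
    reqUnit k = unitOrOne (stream k 2)

    reqEntry : ℕ → Ω → ℕ × ℕ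
    reqEntry k s = unpair (stream k (3 + idx s))

    reqOut : ℕ → Ω → ℕ
    reqOut k s with s ≟Ω v∞₁ | s ≟Ω v∞₂
    ... | no _ | no _ = proj₁ (reqEntry k s)
    ... | _    | _    = 0

    reqIn : ℕ → Ω → ℕ
    reqIn k s with s ≟Ω v∞₁
    ... | yes _ = logAt Lg (reqLevel k) (reqUnit k)
    ... | no _  = proj₂ (reqEntry k s)

    reqOut-v∞₁ : ∀ k → reqOut k v∞₁ ≡ 0
    reqOut-v∞₁ k with v∞₁ ≟Ω v∞₁
    ... | yes _  = refl
    ... | no ne  = ⊥-elim (ne refl)

    reqOut-v∞₂ : ∀ k → reqOut k v∞₂ ≡ 0
    reqOut-v∞₂ k with v∞₂ ≟Ω v∞₁ | v∞₂ ≟Ω v∞₂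
    ... | yes _ | _     = refl
    ... | no _  | yes _ = refl
    ... | no _  | no ne = ⊥-elim (ne refl)

    reqIn-v∞₁ : ∀ k → reqIn k v∞₁ ≡ logAt Lg (reqLevel k) (reqUnit k)
    reqIn-v∞₁ k with v∞₁ ≟Ω v∞₁
    ... | yes _  = refl
    ... | no ne  = ⊥-elim (ne refl)

    bound : List Ω → ℕ
    bound S = max 0 (map (suc ∘ idx) S)

    idx<bound : ∀ {s S} → s ∈ S → idx s < bound S
    idx<bound {S = S} s∈S =
      v<max⁺ 0 (map (suc ∘ idx) S) (inj₂ (Anyₚ.map⁺ (Any.map (λ { refl → ℕ.≤-refl }) s∈S)))

    module _ {S : List Ω} (D : Admissible G S) where
      open Admissible D

      queryStream : ℕ → ℕ
      queryStream 0 = bound S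
      queryStream 1 = n ∸ 1
      queryStream 2 = α
      queryStream (suc (suc (suc i))) = pair (λs₁ (vtx i)) (λs₂ (vtx i))

      queryCode : ℕ
      queryCode = proj₁ (stream-prefix queryStream (3 + bound S))

      queryCode-stream : ∀ i → i < 3 + bound S → stream queryCode i ≡ queryStream i
      queryCode-stream = proj₂ (stream-prefix queryStream (3 + bound S))

      queryCode-level : reqLevel queryCode ≡ n
      queryCode-level = trans (cong suc (queryCode-stream 1 (s≤s (s≤s z≤n)))) (ℕ.m+[n∸m]≡n n≥1)

      queryCode-unit : reqUnit queryCode ≡ α
      queryCode-unit =
        trans (cong unitOrOne (queryCode-stream 2 (s≤s (s≤s (s≤s z≤n))))) (∤⇒unitOrOne≡id α-unit)

      queryCode-set : ∀ {s} → s ∈ S → s ∈ reqSet queryCode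
      queryCode-set {s} s∈S = there (there (subst₂ (λ w N → w ∈ applyUpTo vtx N)
        (vtx-idx s) (sym (queryCode-stream 0 (s≤s z≤n))) (∈-applyUpTo⁺ vtx (idx<bound s∈S))))

      queryCode-entry : ∀ {s} → s ∈ S → reqEntry queryCode s ≡ (λs₁ s , λs₂ s)
      queryCode-entry {s} s∈S = begin
        unpair (stream queryCode (3 + idx s))
          ≡⟨ cong unpair (queryCode-stream (3 + idx s) (s≤s (s≤s (s≤s (idx<bound s∈S))))) ⟩
        unpair (pair (λs₁ (vtx (idx s))) (λs₂ (vtx (idx s))))
          ≡⟨ unpair-pair _ _ ⟩
        (λs₁ (vtx (idx s)) , λs₂ (vtx (idx s)))
          ≡⟨ cong (λ w → λs₁ w , λs₂ w) (vtx-idx s) ⟩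
        (λs₁ s , λs₂ s) ∎
        where open ≡-Reasoning

      queryCode-out : ∀ {s} → s ∈ S → reqOut queryCode s ≋ λs₁ s [mod ℓ ^ fmin n (f s) ]
      queryCode-out {s} s∈S with s ≟Ω v∞₁ | s ≟Ω v∞₂
      ... | yes refl | _        =
        ≈⇒≋ (≈-∣ (^-monoʳ-∣ ℓ (fmin≤ n (f s))) (≈-sym (≋⇒≈ {λs₁ v∞₁} {0} λ-v∞₁-1)))
      ... | no _     | yes refl =
        ≈⇒≋ (≈-∣ (^-monoʳ-∣ ℓ (fmin≤ n (f s))) (≈-sym (≋⇒≈ {λs₁ v∞₂} {0} λ-v∞₂-1)))
      ... | no _     | no _     = ≈⇒≋ (≈-reflexive (cong proj₁ (queryCode-entry s∈S)))

      queryCode-in : ∀ {s} → s ∈ S → reqIn queryCode s ≋ λs₂ s [mod ℓ ^ fmin n (f s) ]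
      queryCode-in {s} s∈S with s ≟Ω v∞₁
      ... | yes refl = ≈⇒≋ (≈-∣ (^-monoʳ-∣ ℓ (fmin≤ n (f s))) (begin
        logAt Lg (reqLevel queryCode) (reqUnit queryCode) ≡⟨ cong₂ (logAt Lg) queryCode-level queryCode-unit ⟩
        logAt Lg n α                                      ≈⟨ ≋⇒≈ λ-v∞₁-2 ⟨
        λs₂ v∞₁                                           ∎))
        where open ≈-Reasoning (ℓ ^ n)
      ... | no _     = ≈⇒≋ (≈-reflexive (cong proj₂ (queryCode-entry s∈S)))

    module Construction (weaklyRado : WeaklyRado G) where

      record Stage : Set where
        field
          scaling : Ω → ℕ
          settled : List Ω
      open Stage

      scope : ℕ → Stage → List Ω
      scope k st = reqSet k ++ settled st

      incoming : ℕ → Stage → Ω → ℕ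
      incoming k st s = unscaleAt (f s) (scaling st s) (reqIn k s)

      query : ∀ {S} → ℕ → Stage → Admissible G S
      query k st = record
        { n       = reqLevel k
        ; n≥1     = s≤s z≤n
        ; α       = reqUnit k
        ; α-unit  = unitOrOne-∤ (stream k 2)
        ; λs₁     = reqOut k
        ; λs₂     = incoming k st
        ; λ-v∞₁-2 = ≈⇒≋ (≈-reflexive (trans (cong (λ L → unscaleAt L (scaling st v∞₁) (reqIn k v∞₁)) f-v∞₁) (reqIn-v∞₁ k)))
        ; λ-v∞₁-1 = ≈⇒≋ (≈-reflexive (reqOut-v∞₁ k))
        ; λ-v∞₂-1 = ≈⇒≋ (≈-reflexive (reqOut-v∞₂ k))
        }

      reply : ∀ k st → WeakReply (scope k st) (reqLevel k) (reqUnit k) (reqOut k) (incoming k st)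
      reply k st =
        weaklyRado (scope k st) (here refl) (there (here refl)) (query k st)

      chosen : ℕ → Stage → Ω
      chosen k st = proj₁ (reply k st)

      factor : ℕ → Stage → ℕ
      factor k st = proj₁ (proj₂ (reply k st))

      factor-∤ : ∀ k st → ¬ ℓ ∣ factor k st
      factor-∤ k st = proj₁ (proj₂ (proj₂ (reply k st)))

      chosen-realises : ∀ k st → Realises lab (scope k st) (reqLevel k) (reqUnit k)
        (λ s → factor k st * reqOut k s) (incoming k st) (chosen k st)
      chosen-realises k st = proj₂ (proj₂ (proj₂ (reply k st)))

      -- The vertex answering request k is rescaled by the inverse of its factor.  It lies outside
      -- everything settled so far, so no scaling is ever revised; settling vtx k makes the limit total.
      step : ℕ → Stage → Stage
      step k st = record
        { scaling = scaling st [ chosen k st ≔ inv (reqLevel k) (factor k st) ]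
        ; settled = vtx k ∷ chosen k st ∷ scope k st
        }

      stage : ℕ → Stage
      stage zero    = record { scaling = λ _ → 1 ; settled = [] }
      stage (suc k) = step k (stage k)

      step-keeps : ∀ {k st w} → w ∈ scope k st → scaling (step k st) w ≡ scaling st w
      step-keeps {k} {st} w∈scope = [≔]-≢ λ { refl → proj₁ (chosen-realises k st) w∈scope }

      stage-stable : ∀ d {j w} → w ∈ settled (stage j) →
        w ∈ settled (stage (d + j)) × scaling (stage (d + j)) w ≡ scaling (stage j) w
      stage-stable zero    w∈ = w∈ , refl
      stage-stable (suc d) {j} w∈ with w∈′ , same ← stage-stable d w∈ =
        there (there (∈-++⁺ʳ (reqSet (d + j)) w∈′)) , trans (step-keeps (∈-++⁺ʳ _ w∈′)) same

      stage-∤ : ∀ k w → ¬ ℓ ∣ scaling (stage k) w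
      stage-∤ zero    _ = ℓ∤1
      stage-∤ (suc k) w with w ≟Ω chosen k (stage k)
      ... | yes _ = inv-∤ (factor k (stage k)) (s≤s z≤n)
      ... | no _  = stage-∤ k w

      limit : Ω → ℕ
      limit w = scaling (stage (suc (idx w))) w

      limit-settled : ∀ {j w} → w ∈ settled (stage j) → limit w ≡ scaling (stage j) w
      limit-settled {j} {w} w∈ = begin
        scaling (stage (suc (idx w))) w      ≡⟨ proj₂ (stage-stable j (here (sym (vtx-idx w)))) ⟨
        scaling (stage (j + suc (idx w))) w  ≡⟨ cong (λ i → scaling (stage i) w) (ℕ.+-comm j _) ⟩
        scaling (stage (suc (idx w) + j)) w  ≡⟨ proj₂ (stage-stable (suc (idx w)) w∈) ⟩
        scaling (stage j) w                  ∎
        where open ≡-Reasoning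

      limit-realises : ∀ k → Realises (scale G limit) (scope k (stage k)) (reqLevel k) (reqUnit k)
        (reqOut k) (reqIn k) (chosen k (stage k))
      limit-realises k = realises-scale {α = reqUnit k} (factor-∤ k (stage k))
        (trans (limit-settled {suc k} (there (here refl))) [≔]-≡)
        (λ s∈scope → trans (limit-settled {suc k} (there (there s∈scope))) (step-keeps s∈scope))
        (λ s _ _ → stage-∤ k s) (chosen-realises k (stage k))

      limit-rado : IsRado G (scale G limit)
      limit-rado S _ _ D = chosen k (stage k) , realised
        where
        open Admissible D
        k : ℕ
        k = queryCode D
        realised : Realises (scale G limit) S n α λs₁ λs₂ (chosen k (stage k))
        realised = realises-restrict {μ = scale G limit} {α = α} {λ₁ = λs₁} {λ₂ = λs₂}
          (∈-++⁺ˡ ∘ queryCode-set D) (queryCode-out D) (queryCode-in D)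
          (subst₂ (λ n α → Realises (scale G limit) (scope k (stage k)) n α (reqOut k) (reqIn k)
                             (chosen k (stage k)))
                  (queryCode-level D) (queryCode-unit D) (limit-realises k))

    weaklyRado⇒radoUpToScaling : WeaklyRado G → RadoUpToScaling G
    weaklyRado⇒radoUpToScaling weaklyRado = limit , (λ w _ _ → stage-∤ (suc (idx w)) w) , limit-rado
      where open Construction weaklyRado

-- The argument never uses that ℓ is odd.
proposition2p5 : (ℓ : ℕ) → Prime ℓ → ¬ (2 ∣ ℓ) → (Lg : LogSystem ℓ) →
    (G : DecGraph ℓ Lg) → RadoUpToScaling G ⇔ WeaklyRado G
proposition2p5 ℓ ℓ-prime _ Lg G =
  mk⇔ (radoUpToScaling⇒weaklyRado ℓ-prime G) (weaklyRado⇒radoUpToScaling ℓ-prime G)
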